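{- Let $n\ge1$ and for each $1\le j\le n$ let $(\mathbf d_j,\mathbf r_j)$ be an arithmetical structure on the cycle $C_3$ (vertices $w_1,w_2,w_3$), with $\mathbf r_j=(r_{j1},r_{j2},r_{j3})$, such that $r_{j1}=r_0$ for all $j$ (a common value $r_0$). Define vectors indexed by the vertices $v_0,\dots,v_{2n}$ of the fan graph $F_n$ by $$\tilde{\mathbf r}=(r_0,r_{12},r_{13},r_{22},r_{23},\dots,r_{n2},r_{n3}),$$ i.e. $\tilde r_{2j-1}=r_{j2}$, $\tilde r_{2j}=r_{j3}$, and $$\tilde d_0=\frac{\sum_{j=1}^n (r_{j2}+r_{j3})}{r_0},\qquad \tilde d_{2j-1}=\frac{r_0+r_{j3}}{r_{j2}},\qquad \tilde d_{2j}=\frac{r_0+r_{j2}}{r_{j3}}\quad(1\le j\le n).$$ Then $(\tilde{\mathbf d},\tilde{\mathbf r})$ is an arithmetical structure on $F_n$.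
   Context: The fan graph $F_n$ has vertices $v_0,\dots,v_{2n}$, with edges $v_0v_i$ for $1\le i\le 2n$ and $v_{2j-1}v_{2j}$ for $1\le j\le n$. For a finite connected graph $G$ with adjacency matrix $A$, an arithmetical structure on $G$ is a pair $(\mathbf d,\mathbf r)$ of vectors of positive integers indexed by the vertices such that $\mathbf r$ is primitive (gcd of entries equal to $1$) and $(\mathrm{diag}(\mathbf d)-A)\mathbf r=0$. -}

module Defs where

open import Data.Nat using (ℕ; zero; suc; _+_; _*_; _<_; _<?_; _/_; _%_; _≟_)
open import Data.Nat.GCD using (gcd)
open import Data.Fin using (Fin; toℕ; fromℕ<)
open import Data.List using (List; map; foldr; allFin)
open import Data.Nat.ListAction using (sum)
open import Data.Product using (_×_)
open import Relation.Nullary using (yes; no)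
open import Relation.Binary.PropositionalEquality using (_≡_)

-- A graph on m vertices is given by its adjacency matrix A : Fin m → Fin m → ℕ.

gcdVec : {m : ℕ} → (Fin m → ℕ) → ℕ
gcdVec {m} r = foldr gcd 0 (map r (allFin m))

matVec : {m : ℕ} → (Fin m → Fin m → ℕ) → (Fin m → ℕ) → Fin m → ℕ
matVec {m} A r i = sum (map (λ k → A i k * r k) (allFin m))

-- Arithmetical structure (d , r) on the graph with adjacency matrix A:
-- d, r positive, r primitive, and (diag d - A) r = 0, i.e. d_i r_i = (A r)_i
-- for every vertex i.
IsArithStructure : {m : ℕ} → (Fin m → Fin m → ℕ) → (Fin m → ℕ) → (Fin m → ℕ) → Set
IsArithStructure {m} A d r =
  ((i : Fin m) → 0 < d i) ×
  ((i : Fin m) → 0 < r i) ×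
  (gcdVec r ≡ 1) ×
  ((i : Fin m) → d i * r i ≡ matVec A r i)

-- Adjacency matrix of the cycle C₃ (vertices w₁,w₂,w₃ = Fin 3 indices 0,1,2):
-- distinct vertices are adjacent.
C3adj : Fin 3 → Fin 3 → ℕ
C3adj i k with toℕ i ≟ toℕ k
... | yes _ = 0
... | no  _ = 1

-- Adjacency on ℕ-indices of the fan graph F_n (vertices v₀,…,v_{2n}):
-- v₀ ~ vᵢ for i ≥ 1, and v_{2j-1} ~ v_{2j}.
fanAdjℕ : ℕ → ℕ → ℕ
fanAdjℕ zero zero = 0
fanAdjℕ zero (suc _) = 1
fanAdjℕ (suc _) zero = 1
fanAdjℕ (suc a) (suc b) with a / 2 ≟ b / 2 | a ≟ b
... | yes _ | no _ = 1
... | _     | _    = 0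

FanAdj : (n : ℕ) → Fin (suc (2 * n)) → Fin (suc (2 * n)) → ℕ
FanAdj n i k = fanAdjℕ (toℕ i) (toℕ k)

-- Division with an (irrelevant) convention for zero denominators;
-- in the theorem all denominators are positive.
_÷_ : ℕ → ℕ → ℕ
a ÷ zero = 0
a ÷ suc b = a / suc b

atℕ : {n : ℕ} → (Fin n → ℕ) → ℕ → ℕ
atℕ {n} f j with j <? n
... | yes p = f (fromℕ< p)
... | no  _ = 0

module FanConstruction (n : ℕ) (r₀ : ℕ) (r : Fin n → Fin 3 → ℕ) where
  -- r_{j2} and r_{j3} (Fin 3 indices 1 and 2), at 0-based index j
  R2 R3 : ℕ → ℕ
  R2 = atℕ (λ j → r j (Data.Fin.suc Data.Fin.zero))
  R3 = atℕ (λ j → r j (Data.Fin.suc (Data.Fin.suc Data.Fin.zero)))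

  -- vertex v_{k+1}, k = 2(j-1) + e : odd vertex v_{2j-1} (e = 0) or v_{2j} (e = 1)
  r̃ℕ : ℕ → ℕ
  r̃ℕ zero = r₀
  r̃ℕ (suc k) with k % 2
  ... | zero = R2 (k / 2)
  ... | suc _ = R3 (k / 2)

  d̃ℕ : ℕ → ℕ
  d̃ℕ zero = sum (map (λ j → r j (Data.Fin.suc Data.Fin.zero)
                          + r j (Data.Fin.suc (Data.Fin.suc Data.Fin.zero)))
                     (allFin n)) ÷ r₀
  d̃ℕ (suc k) with k % 2
  ... | zero  = (r₀ + R3 (k / 2)) ÷ R2 (k / 2)
  ... | suc _ = (r₀ + R2 (k / 2)) ÷ R3 (k / 2)

  r̃ d̃ : Fin (suc (2 * n)) → ℕ
  r̃ i = r̃ℕ (toℕ i)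
  d̃ i = d̃ℕ (toℕ i)

{-# OPTIONS --safe #-}
-- F_n is n copies of the triangle C₃ glued at v₀, which is the vertex w₁ of every copy. At a
-- blade vertex the balance equation of (d̃, r̃) is that of its triangle (v₀ contributes
-- r₀ = r_{j1}), so d̃ there is the corresponding entry of d_j. At v₀ it is the sum over j of
-- the triangles' equations at w₁, whence d̃₀ = Σ_j d_{j1}. Finally r̃ contains every entry
-- of r₁, whose gcd is 1.
module Submission where

open import Defs
open import Data.Nat using (ℕ; _≤_)
open import Data.Fin using (Fin; zero)
open import Relation.Binary.PropositionalEquality using (_≡_)

open import Data.Nat using (suc; _+_; _*_; _<_; _/_; _%_; _≟_; _<?_; s≤s; z≤n)
open import Data.Nat.Properties
  using (+-identityʳ; +-assoc; +-cancelʳ-≡; *-comm; *-identityˡ; *-distribʳ-+;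
         m≤m+n; ≤-trans; +-monoˡ-<; *-monoˡ-≤; suc-injective; module ≤-Reasoning)
open import Data.Nat.DivMod
  using (m*n/n≡m; m*n%n≡0; [m+kn]%n≡m%n; +-distrib-/-∣ʳ; m<n⇒m/n≡0;
         m≡m%n+[m/n]*n; m%n<n; m<n*o⇒m/o<n)
open import Data.Nat.Divisibility using (_∣_; ∣-trans; _∣0; ∣1⇒≡1; n∣m*n)
open import Data.Nat.GCD using (gcd; gcd[m,n]∣m; gcd[m,n]∣n; gcd-greatest)
open import Data.Nat.ListAction using (sum)
open import Data.Fin using (suc; toℕ; fromℕ<; opposite)
open import Data.Fin.Properties using (toℕ<n; toℕ-fromℕ<; fromℕ<-toℕ)
open import Data.List using (map; foldr; tabulate; allFin)
open import Data.List.Properties using (map-tabulate)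
open import Data.Product using (_,_; proj₁; proj₂)
open import Function using (_∘_; id)
open import Relation.Binary.PropositionalEquality
  using (refl; sym; trans; cong; cong₂; subst; _≢_; module ≡-Reasoning)
open import Relation.Nullary using (yes; no; contradiction)

sumBelow : ℕ → (ℕ → ℕ) → ℕ
sumBelow 0       f = 0
sumBelow (suc m) f = f 0 + sumBelow m (f ∘ suc)

syntax sumBelow m (λ k → e) = ∑[ k < m ] e

sumBelow-cong : ∀ m {f g : ℕ → ℕ} → (∀ {k} → k < m → f k ≡ g k) → sumBelow m f ≡ sumBelow m g
sumBelow-cong 0       f≗g = refl
sumBelow-cong (suc m) f≗g = cong₂ _+_ (f≗g (s≤s z≤n)) (sumBelow-cong m (f≗g ∘ s≤s))

sumBelow-zero : ∀ m {f : ℕ → ℕ} → (∀ {k} → k < m → f k ≡ 0) → sumBelow m f ≡ 0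
sumBelow-zero 0       f≗0 = refl
sumBelow-zero (suc m) f≗0 = cong₂ _+_ (f≗0 (s≤s z≤n)) (sumBelow-zero m (f≗0 ∘ s≤s))

sumBelow-single : ∀ {m p} (f : ℕ → ℕ) → p < m → (∀ {k} → k < m → k ≢ p → f k ≡ 0) →
                  sumBelow m f ≡ f p
sumBelow-single {suc m} {0} f _ others≡0 =
  trans (cong (f 0 +_) (sumBelow-zero m (λ k<m → others≡0 (s≤s k<m) λ ())))
        (+-identityʳ (f 0))
sumBelow-single {suc m} {suc p} f (s≤s p<m) others≡0 =
  cong₂ _+_ (others≡0 (s≤s z≤n) λ ())
            (sumBelow-single (f ∘ suc) p<m λ k<m k≢p → others≡0 (s≤s k<m) (k≢p ∘ suc-injective))

sumBelow-distribʳ : ∀ m (f : ℕ → ℕ) c → sumBelow m f * c ≡ ∑[ k < m ] (f k * c)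
sumBelow-distribʳ 0       f c = refl
sumBelow-distribʳ (suc m) f c =
  trans (*-distribʳ-+ c (f 0) _) (cong (f 0 * c +_) (sumBelow-distribʳ m (f ∘ suc) c))

sumBelow-pairs : ∀ m (f : ℕ → ℕ) → sumBelow (m * 2) f ≡ ∑[ j < m ] (f (j * 2) + f (suc (j * 2)))
sumBelow-pairs 0       f = refl
sumBelow-pairs (suc m) f =
  trans (sym (+-assoc (f 0) (f 1) _)) (cong (f 0 + f 1 +_) (sumBelow-pairs m λ k → f (suc (suc k))))

sumBelow-pos : ∀ {m} (f : ℕ → ℕ) → 0 < m → 0 < f 0 → 0 < sumBelow m f
sumBelow-pos {suc m} f _ 0<f0 = ≤-trans 0<f0 (m≤m+n (f 0) _)

sum-tabulate : ∀ m {F : Fin m → ℕ} {G : ℕ → ℕ} → (∀ i → F i ≡ G (toℕ i)) →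
               sum (tabulate F) ≡ sumBelow m G
sum-tabulate 0       F≗G = refl
sum-tabulate (suc m) F≗G = cong₂ _+_ (F≗G zero) (sum-tabulate m (F≗G ∘ suc))

sum-map-allFin : ∀ m {F : Fin m → ℕ} {G : ℕ → ℕ} → (∀ i → F i ≡ G (toℕ i)) →
                 sum (map F (allFin m)) ≡ sumBelow m G
sum-map-allFin m {F} F≗G = trans (cong sum (map-tabulate id F)) (sum-tabulate m F≗G)

gcdVec-tabulate : ∀ {m} (f : Fin m → ℕ) → gcdVec f ≡ foldr gcd 0 (tabulate f)
gcdVec-tabulate f = cong (foldr gcd 0) (map-tabulate id f)

gcdVec-∣ : ∀ {m} (f : Fin m → ℕ) i → gcdVec f ∣ f i
gcdVec-∣ f i = subst (_∣ f i) (sym (gcdVec-tabulate f)) (go f i)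
  where
  go : ∀ {m} (f : Fin m → ℕ) i → foldr gcd 0 (tabulate f) ∣ f i
  go f zero    = gcd[m,n]∣m (f zero) _
  go f (suc i) = ∣-trans (gcd[m,n]∣n (f zero) _) (go (f ∘ suc) i)

gcdVec-greatest : ∀ {m c} (f : Fin m → ℕ) → (∀ i → c ∣ f i) → c ∣ gcdVec f
gcdVec-greatest {c = c} f c∣f = subst (c ∣_) (sym (gcdVec-tabulate f)) (go f c∣f)
  where
  go : ∀ {m} (f : Fin m → ℕ) → (∀ i → c ∣ f i) → c ∣ foldr gcd 0 (tabulate f)
  go {0}     f c∣f = c ∣0
  go {suc m} f c∣f = gcd-greatest (c∣f zero) (go (f ∘ suc) (c∣f ∘ suc))

atℕ-fromℕ< : ∀ {m} (f : Fin m → ℕ) {j} (j<m : j < m) → atℕ f j ≡ f (fromℕ< j<m)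
atℕ-fromℕ< {m} f {j} j<m with j <? m
... | yes _   = refl
... | no  j≮m = contradiction j<m j≮m

atℕ-toℕ : ∀ {m} (f : Fin m → ℕ) i → atℕ f (toℕ i) ≡ f i
atℕ-toℕ f i = trans (atℕ-fromℕ< f (toℕ<n i)) (cong f (fromℕ<-toℕ i (toℕ<n i)))

m*n≡o⇒o÷n≡m : ∀ {m n o} → 0 < n → m * n ≡ o → o ÷ n ≡ m
m*n≡o⇒o÷n≡m {m} {suc n} _ refl = m*n/n≡m m (suc n)

matVec-C3adj-zero : (x : Fin 3 → ℕ) → matVec C3adj x zero ≡ x (suc zero) + x (suc (suc zero))
matVec-C3adj-zero x =
  cong₂ _+_ (+-identityʳ (x (suc zero))) (trans (+-identityʳ _) (+-identityʳ (x (suc (suc zero)))))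

matVec-C3adj-suc : (x : Fin 3 → ℕ) (b : Fin 2) → matVec C3adj x (suc b) ≡ x zero + x (suc (opposite b))
matVec-C3adj-suc x zero =
  cong₂ _+_ (+-identityʳ (x zero)) (trans (+-identityʳ _) (+-identityʳ (x (suc (suc zero)))))
matVec-C3adj-suc x (suc zero) =
  cong₂ _+_ (+-identityʳ (x zero)) (trans (+-identityʳ _) (+-identityʳ (x (suc zero))))

-- v_{2j+1+b} for 0-based j: the copy of vertex suc b of the j-th triangle.
bladeVertex : ℕ → Fin 2 → ℕ
bladeVertex j b = suc (toℕ b + j * 2)

[b+j*2]%2≡b : ∀ j (b : Fin 2) → (toℕ b + j * 2) % 2 ≡ toℕ b
[b+j*2]%2≡b j zero       = m*n%n≡0 j 2
[b+j*2]%2≡b j (suc zero) = [m+kn]%n≡m%n 1 j 2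

[b+j*2]/2≡j : ∀ j (b : Fin 2) → (toℕ b + j * 2) / 2 ≡ j
[b+j*2]/2≡j j b =
  trans (+-distrib-/-∣ʳ (toℕ b) (n∣m*n j)) (cong₂ _+_ (m<n⇒m/n≡0 (toℕ<n b)) (m*n/n≡m j 2))

bladeVertex< : ∀ {n j} (b : Fin 2) → j < n → bladeVertex j b < suc (2 * n)
bladeVertex< {n} {j} b j<n = s≤s (begin-strict
  toℕ b + j * 2  <⟨ +-monoˡ-< (j * 2) (toℕ<n b) ⟩
  suc j * 2      ≤⟨ *-monoˡ-≤ 2 j<n ⟩
  n * 2          ≡⟨ *-comm n 2 ⟩
  2 * n          ∎)
  where open ≤-Reasoning

data FanVertex (n : ℕ) : ℕ → Set where
  hub   : FanVertex n 0
  blade : (j : Fin n) (b : Fin 2) → FanVertex n (bladeVertex (toℕ j) b)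

fanVertex : ∀ {n a} → a < suc (2 * n) → FanVertex n a
fanVertex {a = 0}     _          = hub
fanVertex {n} {suc k} (s≤s k<2n) = subst (FanVertex n) (cong suc b+j*2≡k) (blade j b)
  where
  b : Fin 2
  b = fromℕ< (m%n<n k 2)
  k/2<n : k / 2 < n
  k/2<n = m<n*o⇒m/o<n (subst (k <_) (*-comm 2 n) k<2n)
  j : Fin n
  j = fromℕ< k/2<n
  b+j*2≡k : toℕ b + toℕ j * 2 ≡ k
  b+j*2≡k = trans (cong₂ (λ x y → x + y * 2) (toℕ-fromℕ< (m%n<n k 2)) (toℕ-fromℕ< k/2<n))
                  (sym (m≡m%n+[m/n]*n k 2))

fanAdjℕ-irrefl : ∀ a → fanAdjℕ a a ≡ 0
fanAdjℕ-irrefl 0 = refl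
fanAdjℕ-irrefl (suc a) with a / 2 ≟ a / 2 | a ≟ a
... | yes _ | yes _ = refl
... | no  _ | yes _ = refl
... | _     | no a≢a = contradiction refl a≢a

fanAdjℕ-siblings : ∀ {a b} → a / 2 ≡ b / 2 → a ≢ b → fanAdjℕ (suc a) (suc b) ≡ 1
fanAdjℕ-siblings {a} {b} a≈b a≢b with a / 2 ≟ b / 2 | a ≟ b
... | yes _    | no _    = refl
... | yes _    | yes a≡b = contradiction a≡b a≢b
... | no  a≉b  | _       = contradiction a≈b a≉b

fanAdjℕ-non-siblings : ∀ {a b} → a / 2 ≢ b / 2 → fanAdjℕ (suc a) (suc b) ≡ 0
fanAdjℕ-non-siblings {a} {b} a≉b with a / 2 ≟ b / 2 | a ≟ b
... | yes a≈b | _     = contradiction a≈b a≉b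
... | no  _   | yes _ = refl
... | no  _   | no  _ = refl

fanAdjℕ-blade-partner : ∀ j b → fanAdjℕ (bladeVertex j b) (bladeVertex j (opposite b)) ≡ 1
fanAdjℕ-blade-partner j b =
  fanAdjℕ-siblings (trans ([b+j*2]/2≡j j b) (sym ([b+j*2]/2≡j j (opposite b))))
                   (b≢opposite b ∘ +-cancelʳ-≡ (j * 2) _ _)
  where
  b≢opposite : ∀ (b : Fin 2) → toℕ b ≢ toℕ (opposite b)
  b≢opposite zero       ()
  b≢opposite (suc zero) ()

fanAdjℕ-other-blade : ∀ {j j'} (b c : Fin 2) → j ≢ j' →
                      fanAdjℕ (bladeVertex j b) (bladeVertex j' c) ≡ 0
fanAdjℕ-other-blade {j} {j'} b c j≢j' =
  fanAdjℕ-non-siblings λ j≈j' → j≢j' (trans (sym ([b+j*2]/2≡j j b)) (trans j≈j' ([b+j*2]/2≡j j' c)))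

module FanConstructionProperties (n r₀ : ℕ) (r : Fin n → Fin 3 → ℕ) where
  open FanConstruction n r₀ r public

  rBlade : Fin 2 → ℕ → ℕ
  rBlade b = atℕ (λ j → r j (suc b))

  r̃ℕ-bladeVertex : ∀ j b → r̃ℕ (bladeVertex j b) ≡ rBlade b j
  r̃ℕ-bladeVertex j zero       rewrite [b+j*2]%2≡b j zero       | [b+j*2]/2≡j j zero       = refl
  r̃ℕ-bladeVertex j (suc zero) rewrite [b+j*2]%2≡b j (suc zero) | [b+j*2]/2≡j j (suc zero) = refl

  d̃ℕ-bladeVertex : ∀ j b → d̃ℕ (bladeVertex j b) ≡ (r₀ + rBlade (opposite b) j) ÷ rBlade b j
  d̃ℕ-bladeVertex j zero       rewrite [b+j*2]%2≡b j zero       | [b+j*2]/2≡j j zero       = refl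
  d̃ℕ-bladeVertex j (suc zero) rewrite [b+j*2]%2≡b j (suc zero) | [b+j*2]/2≡j j (suc zero) = refl

  fanRow : ℕ → ℕ
  fanRow a = ∑[ k < suc (2 * n) ] (fanAdjℕ a k * r̃ℕ k)

  matVec-FanAdj : ∀ i → matVec (FanAdj n) r̃ i ≡ fanRow (toℕ i)
  matVec-FanAdj i = sum-map-allFin (suc (2 * n)) {G = λ k → fanAdjℕ (toℕ i) k * r̃ℕ k} λ _ → refl

  bladeTerm : ℕ → ℕ → Fin 2 → ℕ
  bladeTerm a j b = fanAdjℕ a (bladeVertex j b) * r̃ℕ (bladeVertex j b)

  fanRow-by-blades : ∀ a → fanRow a ≡
                     fanAdjℕ a 0 * r₀ + ∑[ j < n ] (bladeTerm a j zero + bladeTerm a j (suc zero))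
  fanRow-by-blades a = cong (fanAdjℕ a 0 * r₀ +_)
    (trans (cong (λ m → sumBelow m λ k → fanAdjℕ a (suc k) * r̃ℕ (suc k)) (*-comm 2 n))
           (sumBelow-pairs n _))

  fanRow-hub : fanRow 0 ≡ ∑[ j < n ] (rBlade zero j + rBlade (suc zero) j)
  fanRow-hub = trans (fanRow-by-blades 0) (sumBelow-cong n λ {j} _ →
    cong₂ _+_ (trans (*-identityˡ _) (r̃ℕ-bladeVertex j zero))
              (trans (*-identityˡ _) (r̃ℕ-bladeVertex j (suc zero))))

  fanRow-blade : ∀ {j} → j < n → ∀ b → fanRow (bladeVertex j b) ≡ r₀ + rBlade (opposite b) j
  fanRow-blade {j} j<n b = begin
    fanRow (bladeVertex j b)
      ≡⟨ fanRow-by-blades (bladeVertex j b) ⟩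
    1 * r₀ + ∑[ j' < n ] (bladeTerm (bladeVertex j b) j' zero + bladeTerm (bladeVertex j b) j' (suc zero))
      ≡⟨ cong₂ _+_ (*-identityˡ r₀) (sumBelow-single _ j<n other-blades) ⟩
    r₀ + (bladeTerm (bladeVertex j b) j zero + bladeTerm (bladeVertex j b) j (suc zero))
      ≡⟨ cong (r₀ +_) (own-blade b) ⟩
    r₀ + rBlade (opposite b) j ∎
    where
    open ≡-Reasoning
    other-blades : ∀ {j'} → j' < n → j' ≢ j →
                   bladeTerm (bladeVertex j b) j' zero + bladeTerm (bladeVertex j b) j' (suc zero) ≡ 0
    other-blades {j'} _ j'≢j =
      cong₂ _+_ (cong (_* r̃ℕ (bladeVertex j' zero)) (fanAdjℕ-other-blade b zero (j'≢j ∘ sym)))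
                (cong (_* r̃ℕ (bladeVertex j' (suc zero))) (fanAdjℕ-other-blade b (suc zero) (j'≢j ∘ sym)))
    own-blade : ∀ b → bladeTerm (bladeVertex j b) j zero + bladeTerm (bladeVertex j b) j (suc zero)
                      ≡ rBlade (opposite b) j
    own-blade zero
      rewrite fanAdjℕ-irrefl (bladeVertex j zero) | fanAdjℕ-blade-partner j zero
            | r̃ℕ-bladeVertex j (suc zero) = +-identityʳ _
    own-blade (suc zero)
      rewrite fanAdjℕ-irrefl (bladeVertex j (suc zero)) | fanAdjℕ-blade-partner j (suc zero)
            | r̃ℕ-bladeVertex j zero = trans (+-identityʳ _) (+-identityʳ _)

module FanArithStructure {n r₀ : ℕ} {d r : Fin n → Fin 3 → ℕ} (n≥1 : 1 ≤ n)
  (triangle : ∀ j → IsArithStructure C3adj (d j) (r j)) (r-hub : ∀ j → r j zero ≡ r₀) where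
  open FanConstructionProperties n r₀ r public

  j₀ : Fin n
  j₀ = fromℕ< n≥1

  d-pos : ∀ j w → 0 < d j w
  d-pos j = proj₁ (triangle j)

  r-pos : ∀ j w → 0 < r j w
  r-pos j = proj₁ (proj₂ (triangle j))

  r-primitive : ∀ j → gcdVec (r j) ≡ 1
  r-primitive j = proj₁ (proj₂ (proj₂ (triangle j)))

  triangle-balance : ∀ j w → d j w * r j w ≡ matVec C3adj (r j) w
  triangle-balance j = proj₂ (proj₂ (proj₂ (triangle j)))

  r₀-pos : 0 < r₀
  r₀-pos = subst (0 <_) (r-hub j₀) (r-pos j₀ zero)

  triangle-balance-zero : ∀ j → d j zero * r₀ ≡ r j (suc zero) + r j (suc (suc zero))
  triangle-balance-zero j = begin
    d j zero * r₀          ≡⟨ cong (d j zero *_) (sym (r-hub j)) ⟩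
    d j zero * r j zero    ≡⟨ triangle-balance j zero ⟩
    matVec C3adj (r j) zero ≡⟨ matVec-C3adj-zero (r j) ⟩
    r j (suc zero) + r j (suc (suc zero)) ∎
    where open ≡-Reasoning

  triangle-balance-suc : ∀ j b → d j (suc b) * r j (suc b) ≡ r₀ + r j (suc (opposite b))
  triangle-balance-suc j b = begin
    d j (suc b) * r j (suc b)      ≡⟨ triangle-balance j (suc b) ⟩
    matVec C3adj (r j) (suc b)     ≡⟨ matVec-C3adj-suc (r j) b ⟩
    r j zero + r j (suc (opposite b)) ≡⟨ cong (_+ r j (suc (opposite b))) (r-hub j) ⟩
    r₀ + r j (suc (opposite b))    ∎
    where open ≡-Reasoning

  rBlade-toℕ : ∀ j b → rBlade b (toℕ j) ≡ r j (suc b)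
  rBlade-toℕ j b = atℕ-toℕ (λ j → r j (suc b)) j

  r̃ℕ-blade : ∀ j b → r̃ℕ (bladeVertex (toℕ j) b) ≡ r j (suc b)
  r̃ℕ-blade j b = trans (r̃ℕ-bladeVertex (toℕ j) b) (rBlade-toℕ j b)

  d̃ℕ-blade : ∀ j b → d̃ℕ (bladeVertex (toℕ j) b) ≡ d j (suc b)
  d̃ℕ-blade j b rewrite d̃ℕ-bladeVertex (toℕ j) b | rBlade-toℕ j b | rBlade-toℕ j (opposite b) =
    m*n≡o⇒o÷n≡m (r-pos j (suc b)) (triangle-balance-suc j b)

  hubD : ℕ
  hubD = ∑[ j < n ] atℕ (λ i → d i zero) j

  hubSum≡hubD*r₀ :
    sum (map (λ j → r j (suc zero) + r j (suc (suc zero))) (allFin n)) ≡ hubD * r₀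
  hubSum≡hubD*r₀ =
    trans (sum-map-allFin n λ i → trans (sym (triangle-balance-zero i))
                                        (cong (_* r₀) (sym (atℕ-toℕ (λ i → d i zero) i))))
          (sym (sumBelow-distribʳ n _ r₀))

  d̃ℕ-hub : d̃ℕ 0 ≡ hubD
  d̃ℕ-hub = m*n≡o⇒o÷n≡m r₀-pos (sym hubSum≡hubD*r₀)

  hub-balance : d̃ℕ 0 * r₀ ≡ fanRow 0
  hub-balance = begin
    d̃ℕ 0 * r₀        ≡⟨ cong (_* r₀) d̃ℕ-hub ⟩
    hubD * r₀   ≡⟨ sym hubSum≡hubD*r₀ ⟩
    sum (map (λ j → r j (suc zero) + r j (suc (suc zero))) (allFin n))
                     ≡⟨ sum-map-allFin n (λ i →
                          sym (cong₂ _+_ (rBlade-toℕ i zero) (rBlade-toℕ i (suc zero)))) ⟩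
    ∑[ j < n ] (rBlade zero j + rBlade (suc zero) j)
                     ≡⟨ sym fanRow-hub ⟩
    fanRow 0         ∎
    where open ≡-Reasoning

  blade-balance : ∀ j b → d̃ℕ (bladeVertex (toℕ j) b) * r̃ℕ (bladeVertex (toℕ j) b)
                          ≡ fanRow (bladeVertex (toℕ j) b)
  blade-balance j b = begin
    d̃ℕ (bladeVertex (toℕ j) b) * r̃ℕ (bladeVertex (toℕ j) b)
      ≡⟨ cong₂ _*_ (d̃ℕ-blade j b) (r̃ℕ-blade j b) ⟩
    d j (suc b) * r j (suc b)
      ≡⟨ triangle-balance-suc j b ⟩
    r₀ + r j (suc (opposite b))
      ≡⟨ cong (r₀ +_) (sym (rBlade-toℕ j (opposite b))) ⟩
    r₀ + rBlade (opposite b) (toℕ j)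
      ≡⟨ sym (fanRow-blade (toℕ<n j) b) ⟩
    fanRow (bladeVertex (toℕ j) b) ∎
    where open ≡-Reasoning

  balance : ∀ {a} → a < suc (2 * n) → d̃ℕ a * r̃ℕ a ≡ fanRow a
  balance a< with fanVertex {n} a<
  ... | hub       = hub-balance
  ... | blade j b = blade-balance j b

  d̃ℕ-pos : ∀ {a} → a < suc (2 * n) → 0 < d̃ℕ a
  d̃ℕ-pos a< with fanVertex {n} a<
  ... | hub       = subst (0 <_) (sym d̃ℕ-hub)
                      (sumBelow-pos _ n≥1 (subst (0 <_) (sym (atℕ-fromℕ< _ n≥1)) (d-pos j₀ zero)))
  ... | blade j b = subst (0 <_) (sym (d̃ℕ-blade j b)) (d-pos j (suc b))

  r̃ℕ-pos : ∀ {a} → a < suc (2 * n) → 0 < r̃ℕ a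
  r̃ℕ-pos a< with fanVertex {n} a<
  ... | hub       = r₀-pos
  ... | blade j b = subst (0 <_) (sym (r̃ℕ-blade j b)) (r-pos j (suc b))

  r̃-primitive : gcdVec r̃ ≡ 1
  r̃-primitive = ∣1⇒≡1 (subst (gcdVec r̃ ∣_) (r-primitive j₀) (gcdVec-greatest (r j₀) ∣r₀))
    where
    ∣r̃ℕ : ∀ {a} → a < suc (2 * n) → gcdVec r̃ ∣ r̃ℕ a
    ∣r̃ℕ a< = subst (λ a → gcdVec r̃ ∣ r̃ℕ a) (toℕ-fromℕ< a<) (gcdVec-∣ r̃ (fromℕ< a<))
    ∣r₀ : ∀ w → gcdVec r̃ ∣ r j₀ w
    ∣r₀ zero    = subst (gcdVec r̃ ∣_) (sym (r-hub j₀)) (∣r̃ℕ (s≤s z≤n))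
    ∣r₀ (suc b) = subst (gcdVec r̃ ∣_) (r̃ℕ-blade j₀ b) (∣r̃ℕ (bladeVertex< b (toℕ<n j₀)))

mainTheorem7 : (n : ℕ) → 1 ≤ n → (r₀ : ℕ) →
    (d r : Fin n → Fin 3 → ℕ) →
    ((j : Fin n) → IsArithStructure C3adj (d j) (r j)) →
    ((j : Fin n) → r j zero ≡ r₀) →
    IsArithStructure (FanAdj n) (FanConstruction.d̃ n r₀ r) (FanConstruction.r̃ n r₀ r)
mainTheorem7 n n≥1 r₀ d r triangle r-hub =
    (λ i → d̃ℕ-pos (toℕ<n i))
  , (λ i → r̃ℕ-pos (toℕ<n i))
  , r̃-primitive
  , (λ i → trans (balance (toℕ<n i)) (sym (matVec-FanAdj i)))
  where open FanArithStructure n≥1 triangle r-hub
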